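{- Let $k, d \in \mathbb{N}$ with $p = \frac{k}{d} \ge 1$, and let $D$ be a digraph. Then $\vec{\chi}^\ast(D) \le p$, i.e., $D$ admits an acyclic $(k,d)$-colouring, if and only if there is a circular homomorphism from $D$ to $\vec{C}(k,d)$.
   Context: Digraphs are loopless but may have parallel and anti-parallel arcs. A vertex set of a digraph is acyclic if the subdigraph it induces contains no directed cycle. For digraphs $D_1, D_2$, a mapping $\phi: V(D_1)\to V(D_2)$ is a circular homomorphism if for every acyclic set $A \subseteq V(D_2)$, the set $\phi^{ -1}(A)$ is acyclic in $D_1$. For $k \ge d \ge 1$, $\vec{C}(k,d)$ is the digraph with vertex set $\mathbb{Z}_k$ having an arc $(i,j)$ if and only if $(j-i) \bmod k \ge d$ (where $x \bmod k$ denotes the representative in $\{0,\dots,k-1\}$). An acyclic $(k,d)$-colouring of a digraph $D$ is a map $c: V(D) \to \mathbb{Z}_k$ such that for every $i \in \mathbb{Z}_k$, the set $c^{ -1}(\{i, i+1, \dots, i+d-1\})$ is acyclic in $D$. The star dichromatic number $\vec{\chi}^\ast(D)$ is the infimum of $\frac{k}{d}$ over all pairs $k \ge d$ for which $D$ admits an acyclic $(k,d)$-colouring; it is known that $D$ has an acyclic $(k,d)$-colouring if and only if $\vec{\chi}^\ast(D) \le \frac{k}{d}$. -}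

module Defs where

open import Level using (0ℓ)
open import Data.Nat using (ℕ; suc; _+_; _∸_; _<_; _≥_; NonZero)
open import Data.Nat.DivMod using (_%_)
open import Data.Fin using (Fin; toℕ)
open import Data.Product using (Σ; _×_)
open import Relation.Nullary using (¬_)

-- Parallel arcs are irrelevant for acyclicity, so arcs are recorded as a
-- relation (Arc u v = "there is at least one arc from u to v").
record Digraph : Set₁ where
  field
    size : ℕ
    Arc  : Fin size → Fin size → Set

open Digraph public

Loopless : Digraph → Set
Loopless D = ∀ v → ¬ Arc D v v

data Path (D : Digraph) (S : Fin (size D) → Set) : Fin (size D) → Fin (size D) → Set where
  edge : ∀ {u v} → S u → S v → Arc D u v → Path D S u v
  step : ∀ {u w v} → S u → Arc D u w → Path D S w v → Path D S u v

Acyclic : (D : Digraph) → (Fin (size D) → Set) → Set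
Acyclic D S = ∀ v → ¬ Path D S v v

CircularHom : (D₁ D₂ : Digraph) → (Fin (size D₁) → Fin (size D₂)) → Set₁
CircularHom D₁ D₂ φ = ∀ (A : Fin (size D₂) → Set) → Acyclic D₂ A → Acyclic D₁ (λ v → A (φ v))

diffMod : (k : ℕ) → .{{NonZero k}} → Fin k → Fin k → ℕ
diffMod k i j = ((toℕ j + k) ∸ toℕ i) % k

Cvec : (k d : ℕ) → .{{NonZero k}} → Digraph
Cvec k d = record { size = k ; Arc = λ i j → diffMod k i j ≥ d }

-- acyclic (k,d)-colouring: for each i, c⁻¹({i,…,i+d-1}) is acyclic
AcyclicColouring : (D : Digraph) (k d : ℕ) → .{{NonZero k}} → (Fin (size D) → Fin k) → Set
AcyclicColouring D k d c = ∀ (i : Fin k) → Acyclic D (λ v → diffMod k i (c v) < d)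

module Submission where

-- A circular homomorphism pulls back the acyclic "intervals" {j : (j - i) mod k < d}
-- of C(k,d) (along an arc inside such an interval the offset from i strictly
-- decreases), and these pullbacks are exactly the sets required of a colouring.
-- Conversely, if a colouring c pulled back an acyclic set A to a set containing a
-- cycle, then for every colour s that cycle would leave the interval at s, giving a
-- colour of A at distance ≥ d from s, i.e. an out-neighbour of s in A; iterating
-- from a colour on the cycle produces a closed walk in A.

open import Defs
open import Data.Nat using (ℕ; _≤_; NonZero)
open import Data.Fin using (Fin)
open import Data.Product using (Σ; _×_)
open import Function.Bundles using (_⇔_)

open import Data.Nat using (zero; suc; _+_; _∸_; _<_; _<?_)
open import Data.Nat.Properties
open import Data.Nat.DivMod using (_%_; %-distribˡ-+; [m+n]%n≡m%n; m%n<n; m%n≤m; m<n⇒m%n≡m)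
open import Data.Fin using (toℕ)
open import Data.Fin.Properties using (pigeonhole; toℕ<n)
open import Data.Product using (_,_; proj₁; proj₂)
open import Data.Sum using (_⊎_; inj₁; inj₂)
open import Relation.Nullary using (¬_; yes; no; contradiction)
open import Relation.Unary using (Decidable)
open import Relation.Binary.PropositionalEquality using (_≡_; refl; sym; cong; subst; module ≡-Reasoning)
open import Function.Bundles using (mk⇔)

module _ {D : Digraph} {S : Fin (size D) → Set} where

  Path-source : ∀ {u v} → Path D S u v → S u
  Path-source (edge su _ _) = su
  Path-source (step su _ _) = su

  Path-snoc : ∀ {u v w} → Path D S u v → Arc D v w → S w → Path D S u w
  Path-snoc (edge su sv a) b sw = step su a (edge sv sw b)
  Path-snoc (step su a p)  b sw = step su a (Path-snoc p b sw)

  Path-outsideVertex : ∀ {Q : Fin (size D) → Set} → Decidable Q → ∀ {u v} →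
    Path D S u v → ¬ Path D Q u v → Σ (Fin (size D)) λ w → S w × ¬ Q w
  Path-outsideVertex Q? {u} {v} (edge su sv a) ¬pQ with Q? u | Q? v
  ... | yes qu | yes qv = contradiction (edge qu qv a) ¬pQ
  ... | no ¬qu | _      = u , su , ¬qu
  ... | yes _  | no ¬qv = v , sv , ¬qv
  Path-outsideVertex Q? {u} (step su a p) ¬pQ with Q? u
  ... | yes qu = Path-outsideVertex Q? p (λ q → ¬pQ (step qu a q))
  ... | no ¬qu = u , su , ¬qu

  successorClosed⇒¬acyclic : (next : ∀ x → S x → Σ (Fin (size D)) λ y → S y × Arc D x y) →
    ∀ {x₀} → S x₀ → ¬ Acyclic D S
  successorClosed⇒¬acyclic next {x₀} sx₀ acyclic = acyclic (proj₁ closedWalk) (proj₂ closedWalk)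
    where
    walk : ℕ → Σ (Fin (size D)) S
    walk zero    = x₀ , sx₀
    walk (suc n) with y , sy , _ ← next (proj₁ (walk n)) (proj₂ (walk n)) = y , sy

    orbit : ℕ → Fin (size D)
    orbit n = proj₁ (walk n)

    orbit-arc : ∀ n → Arc D (orbit n) (orbit (suc n))
    orbit-arc n = proj₂ (proj₂ (next (orbit n) (proj₂ (walk n))))

    orbit-path : ∀ {m n} → m < n → Path D S (orbit m) (orbit n)
    orbit-path {m} {suc n} m<1+n with m<1+n⇒m<n∨m≡n m<1+n
    ... | inj₁ m<n  = Path-snoc (orbit-path m<n) (orbit-arc n) (proj₂ (walk (suc n)))
    ... | inj₂ refl = edge (proj₂ (walk m)) (proj₂ (walk (suc m))) (orbit-arc m)

    closedWalk : Σ (Fin (size D)) λ x → Path D S x x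
    closedWalk with i , _ , i<j , orbitᵢ≡orbitⱼ ← pigeonhole (n<1+n (size D)) (λ i → orbit (toℕ i))
      = orbit (toℕ i) , subst (Path D S _) (sym orbitᵢ≡orbitⱼ) (orbit-path i<j)

mod-sum-wraps : ∀ {m n k} .{{_ : NonZero k}} → m < k → n < k →
  (m + n) % k ≡ m + n ⊎ (m + n) % k < m
mod-sum-wraps {m} {n} {k} m<k n<k with m + n <? k
... | yes m+n<k = inj₁ (m<n⇒m%n≡m m+n<k)
... | no m+n≮k  = inj₂ (begin-strict
    (m + n) % k          ≡⟨ cong (_% k) (sym (m∸n+n≡m k≤m+n)) ⟩
    (m + n ∸ k + k) % k  ≡⟨ [m+n]%n≡m%n (m + n ∸ k) k ⟩
    (m + n ∸ k) % k      ≤⟨ m%n≤m (m + n ∸ k) k ⟩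
    m + n ∸ k            <⟨ ∸-monoˡ-< (+-monoʳ-< m n<k) k≤m+n ⟩
    m + k ∸ k            ≡⟨ m+n∸n≡m m k ⟩
    m                    ∎)
  where
  open ≤-Reasoning
  k≤m+n = ≮⇒≥ m+n≮k

module _ (k : ℕ) .{{_ : NonZero k}} where

  diffMod-+ : ∀ i a b → (diffMod k i a + diffMod k a b) % k ≡ diffMod k i b
  diffMod-+ i a b = begin
    ((A + k ∸ I) % k + (B + k ∸ A) % k) % k  ≡⟨ sym (%-distribˡ-+ (A + k ∸ I) (B + k ∸ A) k) ⟩
    ((A + k ∸ I) + (B + k ∸ A)) % k          ≡⟨ cong (_% k) (+-comm (A + k ∸ I) (B + k ∸ A)) ⟩
    ((B + k ∸ A) + (A + k ∸ I)) % k          ≡⟨ cong (_% k) (sym (+-∸-assoc (B + k ∸ A) I≤A+k)) ⟩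
    ((B + k ∸ A) + (A + k) ∸ I) % k          ≡⟨ cong (λ x → (x ∸ I) % k) (sym (+-assoc (B + k ∸ A) A k)) ⟩
    ((B + k ∸ A) + A + k ∸ I) % k            ≡⟨ cong (λ x → (x + k ∸ I) % k) (m∸n+n≡m A≤B+k) ⟩
    (B + k + k ∸ I) % k                      ≡⟨ cong (_% k) (+-∸-comm k I≤B+k) ⟩
    (B + k ∸ I + k) % k                      ≡⟨ [m+n]%n≡m%n (B + k ∸ I) k ⟩
    (B + k ∸ I) % k                          ∎
    where
    open ≡-Reasoning
    I = toℕ i
    A = toℕ a
    B = toℕ b
    I≤A+k = ≤-trans (<⇒≤ (toℕ<n i)) (m≤n+m k A)
    I≤B+k = ≤-trans (<⇒≤ (toℕ<n i)) (m≤n+m k B)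
    A≤B+k = ≤-trans (<⇒≤ (toℕ<n a)) (m≤n+m k B)

  module _ (d : ℕ) where

    Interval : Fin k → Fin k → Set
    Interval i j = diffMod k i j < d

    -- An arc has length ≥ d, so adding it to an offset that stays below d must wrap past k.
    arc-decreasesOffset : ∀ i {a b} → Arc (Cvec k d) a b → Interval i b →
      diffMod k i b < diffMod k i a
    arc-decreasesOffset i {a} {b} d≤ab b∈i
      with mod-sum-wraps (m%n<n _ k) (m%n<n _ k) | diffMod-+ i a b
    ... | inj₁ noWrap | sum≡ib = contradiction b∈i (≤⇒≯ (≤-trans d≤ab (begin
          diffMod k a b                        ≤⟨ m≤n+m (diffMod k a b) (diffMod k i a) ⟩
          diffMod k i a + diffMod k a b        ≡⟨ sym noWrap ⟩
          (diffMod k i a + diffMod k a b) % k  ≡⟨ sum≡ib ⟩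
          diffMod k i b                        ∎)))
      where open ≤-Reasoning
    ... | inj₂ wraps | sum≡ib = subst (_< diffMod k i a) sum≡ib wraps

    path-decreasesOffset : ∀ i {a b} → Path (Cvec k d) (Interval i) a b →
      diffMod k i b < diffMod k i a
    path-decreasesOffset i (edge _ b∈i ab) = arc-decreasesOffset i ab b∈i
    path-decreasesOffset i (step _ aw p)    =
      <-trans (path-decreasesOffset i p) (arc-decreasesOffset i aw (Path-source p))

    interval-acyclic : ∀ i → Acyclic (Cvec k d) (Interval i)
    interval-acyclic i v cycle = <-irrefl refl (path-decreasesOffset i cycle)

    circularHom⇒acyclicColouring : ∀ D φ → CircularHom D (Cvec k d) φ → AcyclicColouring D k d φ
    circularHom⇒acyclicColouring D φ hom i = hom (Interval i) (interval-acyclic i)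

    acyclicColouring⇒circularHom : ∀ D c → AcyclicColouring D k d c → CircularHom D (Cvec k d) c
    acyclicColouring⇒circularHom D c colouring A A-acyclic v cycle =
      successorClosed⇒¬acyclic next (Path-source cycle) A-acyclic
      where
      next : ∀ s → A s → Σ (Fin k) λ t → A t × Arc (Cvec k d) s t
      next s _ with w , Acw , cw∉s ← Path-outsideVertex (λ w → diffMod k s (c w) <? d)
                                       cycle (colouring s v)
        = c w , Acw , ≮⇒≥ cw∉s

mainTheorem2 : (k d : ℕ) → .{{_ : NonZero k}} → 1 ≤ d → d ≤ k →
    (D : Digraph) → Loopless D →
    (Σ (Fin (size D) → Fin k) (λ c → AcyclicColouring D k d c))
    ⇔ (Σ (Fin (size D) → Fin k) (λ φ → CircularHom D (Cvec k d) φ))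
mainTheorem2 k d _ _ D _ = mk⇔
  (λ (c , colouring) → c , acyclicColouring⇒circularHom k d D c colouring)
  (λ (φ , hom) → φ , circularHom⇒acyclicColouring k d D φ hom)
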